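{- Let $n\ge 2$ and let $\mathrm{WICG}(n;C)$ be a weighted integral circulant graph with integer weights $C=\{c_d:d\in D_n\}$, and define $\lambda_j=\sum_{i=0}^{n-1}c_i\omega_n^{ji}$ for integers $j\ge0$ (the eigenvalues, indices taken mod $n$). Then $\lambda_2-\lambda_1$ is an even integer.
   Context: $D_n$ is the set of positive divisors of $n$ less than $n$; $\omega_n=e^{2\pi i/n}$. Given integers $c_d$ ($d\in D_n$), $\mathrm{WICG}(n;C)$ is the weighted circulant graph on $\mathbb{Z}_n$ whose adjacency matrix is the circulant matrix with first row $(c_0,\ldots,c_{n-1})$, where $c_0=0$ and $c_i=c_d$ whenever $\gcd(i,n)=d$. -}

module Defs where

open import Level using (Level)
open import Data.Nat as ℕ using (ℕ; zero; suc)
open import Data.Nat.GCD using (gcd)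
open import Data.Integer as ℤ using (ℤ; +_; -[1+_])
open import Data.Sum using (_⊎_)
open import Data.Product using (∃)
open import Relation.Binary.PropositionalEquality using (_≡_)
open import Relation.Nullary using (¬_)
open import Algebra.Bundles using (CommutativeRing)

-- Weight of vertex difference i (0 ≤ i < n) in WICG(n;C):
-- c_0 = 0 and c_i = C (gcd i n) for 1 ≤ i < n (gcd i n is then a proper divisor of n).
-- C is given as a function ℕ → ℤ; only its values on D_n are ever used.
weight : (n : ℕ) → (C : ℕ → ℤ) → ℕ → ℤ
weight n C zero    = + 0
weight n C (suc i) = C (gcd (suc i) n)

module _ {c ℓ : Level} (R : CommutativeRing c ℓ) where
  open CommutativeRing R

  pow : Carrier → ℕ → Carrier
  pow x zero    = 1#
  pow x (suc k) = x * pow x k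

  natR : ℕ → Carrier
  natR zero    = 0#
  natR (suc k) = 1# + natR k

  intR : ℤ → Carrier
  intR (+ k)      = natR k
  intR -[1+ k ]   = - natR (suc k)

  sumR : (ℕ → Carrier) → ℕ → Carrier
  sumR f zero    = 0#
  sumR f (suc m) = sumR f m + f m

  IsIntegralDomain : Set _
  IsIntegralDomain = (¬ (1# ≈ 0#)) × ((x y : Carrier) → x * y ≈ 0# → (x ≈ 0#) ⊎ (y ≈ 0#))
    where open import Data.Product using (_×_)

  CharZero : Set _
  CharZero = (m : ℕ) → natR m ≈ 0# → m ≡ 0

  IsPrimitiveRoot : ℕ → Carrier → Set _
  IsPrimitiveRoot n ω = (pow ω n ≈ 1#) × ((k : ℕ) → 0 ℕ.< k → k ℕ.< n → ¬ (pow ω k ≈ 1#))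
    where open import Data.Product using (_×_)

  eigen : (n : ℕ) → (C : ℕ → ℤ) → Carrier → ℕ → Carrier
  eigen n C ω j = sumR (λ i → intR (weight n C i) * pow ω (j ℕ.* i)) n

  IsEvenInteger : Carrier → Set _
  IsEvenInteger x = ∃ λ (k : ℤ) → x ≈ intR (+ 2 ℤ.* k)

module Submission where

-- Write w_i = ω^{2i} − ω^i, so that λ₂ − λ₁ = Σ_{i<n} c_i w_i.  Since w_0 = 0
-- the i = 0 term may be replaced by C(gcd 0 n), and the gap becomes
-- D(F) = Σ_{i<n} F(gcd(i,n)) w_i for the function F = C on divisors of n.
--
-- D is linear in F, so we sieve F along the divisors t = 1, 2, … of n: once F
-- vanishes on the divisors below t, subtracting F(t)·[t ∣ d] makes it vanish
-- on the divisors below t + 1, and changes D(F) by F(t)·S(t), where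
-- S(t) = Σ_{i<n, t ∣ i} w_i.  Writing n = m·t, S(t) is a difference of two
-- geometric sums of m-th roots of unity, ω^{2t} and ω^t, each of which is 0
-- unless the root is 1 (here we use that R is an integral domain).  This
-- gives S(t) = 0 for m ≠ 2 and S(t) = 2 for m = 2, so every sieving step
-- changes D(F) by an even integer, and after all steps D(F) = 0.

open import Level using (Level)
open import Data.Nat as ℕ using (ℕ; zero; suc; _≤_; _<_; z≤n; s≤s)
import Data.Nat.Properties as ℕP
import Data.Nat.Tactic.RingSolver as ℕSolver
open import Data.Nat.Divisibility
  using (_∣_; divides; _∣?_; ∣-refl; ∣-trans; ∣⇒≤; ∣m+n∣m⇒∣n; n∣m*n; 0∣⇒≡0)
open import Data.Nat.GCD using (gcd; gcd[m,n]∣m; gcd[m,n]∣n; gcd-greatest)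
open import Data.Integer as ℤ using (ℤ; +_; -[1+_]; _⊖_)
import Data.Integer.Properties as ℤP
import Data.Integer.Tactic.RingSolver as ℤSolver
open import Data.Product using (_,_; proj₁; proj₂)
open import Data.Sum using (_⊎_; inj₁; inj₂)
open import Data.Empty using (⊥-elim)
open import Relation.Nullary using (¬_; yes; no)
open import Relation.Binary.PropositionalEquality as ≡ using (_≡_)
open import Algebra.Bundles using (CommutativeRing)
open import Defs

-- Downward induction: a property holding at m and inherited from t + 1 by t
-- holds at every t ≤ m.  The sieve runs from t = n + 1 down to t = 0.
downward-induction : ∀ {p} (P : ℕ → Set p) (m : ℕ) → P m →
                     (∀ t → P (suc t) → P t) → ∀ t → t ≤ m → P t
downward-induction P m Pm step t t≤m = from-gap (m ℕ.∸ t) t (ℕP.m∸n+n≡m t≤m)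
  where
  from-gap : ∀ k t → k ℕ.+ t ≡ m → P t
  from-gap zero    t ≡.refl = Pm
  from-gap (suc k) t k+t≡m  = step t (from-gap k (suc t) (≡.trans (ℕP.+-suc k t) k+t≡m))

peel : ℕ → (ℕ → ℤ) → ℕ → ℤ
peel t F d with t ∣? d
... | yes _ = F d ℤ.- F t
... | no  _ = F d

peel-self : ∀ t F → peel t F t ≡ + 0
peel-self t F with t ∣? t
... | yes _   = ℤP.+-inverseʳ (F t)
... | no  t∤t = ⊥-elim (t∤t ∣-refl)

peel-no : ∀ {t d} F → ¬ t ∣ d → peel t F d ≡ F d
peel-no {t} {d} F t∤d with t ∣? d
... | yes t∣d = ⊥-elim (t∤d t∣d)
... | no  _   = ≡.refl

module InCommutativeRing {c ℓ : Level} (R : CommutativeRing c ℓ) where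
  open CommutativeRing R
  open import Relation.Binary.Reasoning.Setoid setoid
  open import Algebra.Properties.Ring ring
    using (-0#≈0#; -‿involutive; -‿+-comm; x∙y⁻¹≈ε⇒x≈y; [y-z]x≈yx-zx)
  open import Algebra.Properties.CommutativeSemigroup +-commutativeSemigroup
    using (interchange)

  cancel-summand : ∀ x a b → (x + a) - (x + b) ≈ a - b
  cancel-summand x a b = begin
    (x + a) - (x + b)         ≈⟨ +-congˡ (-‿+-comm x b) ⟨
    (x + a) + (- x + - b)     ≈⟨ interchange x a (- x) (- b) ⟩
    (x - x) + (a - b)         ≈⟨ +-congʳ (-‿inverseʳ x) ⟩
    0# + (a - b)              ≈⟨ +-identityˡ (a - b) ⟩
    a - b                     ∎

  natR-+ : ∀ a b → natR R (a ℕ.+ b) ≈ natR R a + natR R b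
  natR-+ zero    b = sym (+-identityˡ (natR R b))
  natR-+ (suc a) b = trans (+-congˡ (natR-+ a b)) (sym (+-assoc 1# (natR R a) (natR R b)))

  intR-⊖ : ∀ a b → intR R (a ⊖ b) ≈ natR R a - natR R b
  intR-⊖ a zero = begin
    intR R (a ⊖ 0)     ≡⟨ ≡.cong (intR R) (ℤP.⊖-≥ {a} z≤n) ⟩
    natR R a           ≈⟨ +-identityʳ (natR R a) ⟨
    natR R a + 0#      ≈⟨ +-congˡ -0#≈0# ⟨
    natR R a - 0#      ∎
  intR-⊖ zero    (suc b) = sym (+-identityˡ _)
  intR-⊖ (suc a) (suc b) = begin
    intR R (suc a ⊖ suc b)          ≡⟨ ≡.cong (intR R) (ℤP.[1+m]⊖[1+n]≡m⊖n a b) ⟩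
    intR R (a ⊖ b)                  ≈⟨ intR-⊖ a b ⟩
    natR R a - natR R b             ≈⟨ cancel-summand 1# (natR R a) (natR R b) ⟨
    natR R (suc a) - natR R (suc b) ∎

  intR-+ : ∀ a b → intR R (a ℤ.+ b) ≈ intR R a + intR R b
  intR-+ (+ a)    (+ b)    = natR-+ a b
  intR-+ (+ a)    -[1+ b ] = intR-⊖ a (suc b)
  intR-+ -[1+ a ] (+ b)    = trans (intR-⊖ b (suc a)) (+-comm _ _)
  intR-+ -[1+ a ] -[1+ b ] = begin
    - natR R (suc (suc (a ℕ.+ b)))       ≡⟨ ≡.cong (λ k → - natR R (suc k)) (ℕP.+-suc a b) ⟨
    - natR R (suc a ℕ.+ suc b)           ≈⟨ -‿cong (natR-+ (suc a) (suc b)) ⟩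
    - (natR R (suc a) + natR R (suc b))  ≈⟨ -‿+-comm _ _ ⟨
    - natR R (suc a) + - natR R (suc b)  ∎

  intR-neg : ∀ a → intR R (ℤ.- a) ≈ - intR R a
  intR-neg (+ zero)  = sym -0#≈0#
  intR-neg (+ suc a) = refl
  intR-neg -[1+ a ]  = sym (-‿involutive _)

  intR-sub : ∀ a b → intR R (a ℤ.- b) ≈ intR R a - intR R b
  intR-sub a b = trans (intR-+ a (ℤ.- b)) (+-congˡ (intR-neg b))

  even-cong : ∀ {x y} → x ≈ y → IsEvenInteger R y → IsEvenInteger R x
  even-cong x≈y (k , y≈2k) = k , trans x≈y y≈2k

  even-+ : ∀ {x y} → IsEvenInteger R x → IsEvenInteger R y → IsEvenInteger R (x + y)
  even-+ {x} {y} (k , x≈2k) (l , y≈2l) = k ℤ.+ l , (begin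
    x + y                               ≈⟨ +-cong x≈2k y≈2l ⟩
    intR R (+ 2 ℤ.* k) + intR R (+ 2 ℤ.* l) ≈⟨ intR-+ (+ 2 ℤ.* k) (+ 2 ℤ.* l) ⟨
    intR R (+ 2 ℤ.* k ℤ.+ + 2 ℤ.* l)    ≡⟨ ≡.cong (intR R) (ℤP.*-distribˡ-+ (+ 2) k l) ⟨
    intR R (+ 2 ℤ.* (k ℤ.+ l))          ∎)

  even-double : ∀ a → IsEvenInteger R (intR R a * (1# + 1#))
  even-double a = a , (begin
    intR R a * (1# + 1#)            ≈⟨ distribˡ (intR R a) 1# 1# ⟩
    intR R a * 1# + intR R a * 1#   ≈⟨ +-cong (*-identityʳ _) (*-identityʳ _) ⟩
    intR R a + intR R a             ≈⟨ intR-+ a a ⟨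
    intR R (a ℤ.+ a)                ≡⟨ ≡.cong (intR R) (double a) ⟩
    intR R (+ 2 ℤ.* a)              ∎)
    where
    double : ∀ a → a ℤ.+ a ≡ + 2 ℤ.* a
    double = ℤSolver.solve-∀

  pow-cong : ∀ {x y} k → x ≈ y → pow R x k ≈ pow R y k
  pow-cong zero    x≈y = refl
  pow-cong (suc k) x≈y = *-cong x≈y (pow-cong k x≈y)

  pow-one : ∀ k → pow R 1# k ≈ 1#
  pow-one zero    = refl
  pow-one (suc k) = trans (*-identityˡ _) (pow-one k)

  open import Algebra.Properties.Semiring.Exp semiring using (_^_; ^-assocʳ)

  pow≡^ : ∀ x k → pow R x k ≡ x ^ k
  pow≡^ x zero    = ≡.refl
  pow≡^ x (suc k) = ≡.cong (x *_) (pow≡^ x k)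

  pow-* : ∀ x a b → pow R x (a ℕ.* b) ≈ pow R (pow R x a) b
  pow-* x a b = begin
    pow R x (a ℕ.* b)   ≡⟨ pow≡^ x (a ℕ.* b) ⟩
    x ^ (a ℕ.* b)       ≈⟨ ^-assocʳ x a b ⟨
    (x ^ a) ^ b         ≡⟨ ≡.cong (_^ b) (pow≡^ x a) ⟨
    pow R x a ^ b       ≡⟨ pow≡^ (pow R x a) b ⟨
    pow R (pow R x a) b ∎

  pow-multiple-of-order : ∀ {x} n j → pow R x n ≈ 1# → pow R x (n ℕ.* j) ≈ 1#
  pow-multiple-of-order {x} n j xⁿ≈1 = begin
    pow R x (n ℕ.* j)   ≈⟨ pow-* x n j ⟩
    pow R (pow R x n) j ≈⟨ pow-cong j xⁿ≈1 ⟩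
    pow R 1# j          ≈⟨ pow-one j ⟩
    1#                  ∎

  sumR-cong : ∀ {f g : ℕ → Carrier} m → (∀ i → i < m → f i ≈ g i) → sumR R f m ≈ sumR R g m
  sumR-cong zero    f≈g = refl
  sumR-cong (suc m) f≈g = +-cong (sumR-cong m (λ i i<m → f≈g i (ℕP.m<n⇒m<1+n i<m))) (f≈g m ℕP.≤-refl)

  sumR-zero : ∀ {f : ℕ → Carrier} m → (∀ i → i < m → f i ≈ 0#) → sumR R f m ≈ 0#
  sumR-zero zero    f≈0 = refl
  sumR-zero (suc m) f≈0 =
    trans (+-cong (sumR-zero m (λ i i<m → f≈0 i (ℕP.m<n⇒m<1+n i<m))) (f≈0 m ℕP.≤-refl)) (+-identityˡ 0#)

  sumR-+ : ∀ (f g : ℕ → Carrier) m → sumR R (λ i → f i + g i) m ≈ sumR R f m + sumR R g m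
  sumR-+ f g zero    = sym (+-identityˡ 0#)
  sumR-+ f g (suc m) = trans (+-congʳ (sumR-+ f g m)) (interchange _ _ _ _)

  sumR-neg : ∀ (f : ℕ → Carrier) m → sumR R (λ i → - f i) m ≈ - sumR R f m
  sumR-neg f zero    = sym -0#≈0#
  sumR-neg f (suc m) = trans (+-congʳ (sumR-neg f m)) (-‿+-comm _ _)

  sumR-- : ∀ (f g : ℕ → Carrier) m → sumR R (λ i → f i - g i) m ≈ sumR R f m - sumR R g m
  sumR-- f g m = trans (sumR-+ f (λ i → - g i) m) (+-congˡ (sumR-neg g m))

  sumR-* : ∀ a (f : ℕ → Carrier) m → sumR R (λ i → a * f i) m ≈ a * sumR R f m
  sumR-* a f zero    = sym (zeroʳ a)
  sumR-* a f (suc m) = trans (+-congʳ (sumR-* a f m)) (sym (distribˡ a _ _))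

  sumR-split : ∀ (f : ℕ → Carrier) a b → sumR R f (a ℕ.+ b) ≈ sumR R f a + sumR R (λ r → f (a ℕ.+ r)) b
  sumR-split f a zero = begin
    sumR R f (a ℕ.+ 0)  ≡⟨ ≡.cong (sumR R f) (ℕP.+-identityʳ a) ⟩
    sumR R f a          ≈⟨ +-identityʳ _ ⟨
    sumR R f a + 0#     ∎
  sumR-split f a (suc b) = begin
    sumR R f (a ℕ.+ suc b)                                      ≡⟨ ≡.cong (sumR R f) (ℕP.+-suc a b) ⟩
    sumR R f (a ℕ.+ b) + f (a ℕ.+ b)                            ≈⟨ +-congʳ (sumR-split f a b) ⟩
    (sumR R f a + sumR R (λ r → f (a ℕ.+ r)) b) + f (a ℕ.+ b)   ≈⟨ +-assoc _ _ _ ⟩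
    sumR R f a + sumR R (λ r → f (a ℕ.+ r)) (suc b)             ∎

  divInd : ℕ → ℕ → Carrier
  divInd t d with t ∣? d
  ... | yes _ = 1#
  ... | no  _ = 0#

  divInd-yes : ∀ {t d} → t ∣ d → divInd t d ≡ 1#
  divInd-yes {t} {d} t∣d with t ∣? d
  ... | yes _   = ≡.refl
  ... | no  t∤d = ⊥-elim (t∤d t∣d)

  divInd-no : ∀ {t d} → ¬ t ∣ d → divInd t d ≡ 0#
  divInd-no {t} {d} t∤d with t ∣? d
  ... | yes t∣d = ⊥-elim (t∤d t∣d)
  ... | no  _   = ≡.refl

  divInd-equiv : ∀ {t a b} → (t ∣ a → t ∣ b) → (t ∣ b → t ∣ a) → divInd t a ≡ divInd t b
  divInd-equiv {t} {a} {b} a⇒b b⇒a with t ∣? b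
  ... | yes t∣b = divInd-yes (b⇒a t∣b)
  ... | no  t∤b = divInd-no (λ t∣a → t∤b (a⇒b t∣a))

  one-multiple-per-block : ∀ t (g : ℕ → Carrier) k → suc t ∣ k →
    sumR R (λ r → divInd (suc t) (k ℕ.+ r) * g (k ℕ.+ r)) (suc t) ≈ g k
  one-multiple-per-block t g k t∣k = begin
    sumR R term (1 ℕ.+ t)                          ≈⟨ sumR-split term 1 t ⟩
    (0# + term 0) + sumR R (λ r → term (suc r)) t  ≈⟨ +-cong (+-identityˡ _) (sumR-zero t not-multiple) ⟩
    term 0 + 0#                                    ≈⟨ +-identityʳ _ ⟩
    term 0                                         ≡⟨ ≡.cong (λ i → divInd (suc t) i * g i) (ℕP.+-identityʳ k) ⟩
    divInd (suc t) k * g k                         ≡⟨ ≡.cong (_* g k) (divInd-yes t∣k) ⟩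
    1# * g k                                       ≈⟨ *-identityˡ (g k) ⟩
    g k                                            ∎
    where
    term : ℕ → Carrier
    term r = divInd (suc t) (k ℕ.+ r) * g (k ℕ.+ r)
    not-multiple : ∀ r → r < t → term (suc r) ≈ 0#
    not-multiple r r<t = trans (*-congʳ (reflexive (divInd-no t∤k+r))) (zeroˡ _)
      where
      t∤k+r : ¬ suc t ∣ k ℕ.+ suc r
      t∤k+r t∣k+r = ℕP.<⇒≱ (s≤s r<t) (∣⇒≤ (∣m+n∣m⇒∣n t∣k+r t∣k))

  sum-over-multiples : ∀ t (g : ℕ → Carrier) m →
    sumR R (λ i → divInd (suc t) i * g i) (m ℕ.* suc t) ≈ sumR R (λ s → g (s ℕ.* suc t)) m
  sum-over-multiples t g zero    = refl
  sum-over-multiples t g (suc m) = begin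
    sumR R term (suc t ℕ.+ mt)                                  ≡⟨ ≡.cong (sumR R term) (ℕP.+-comm (suc t) mt) ⟩
    sumR R term (mt ℕ.+ suc t)                                  ≈⟨ sumR-split term mt (suc t) ⟩
    sumR R term mt + sumR R (λ r → term (mt ℕ.+ r)) (suc t)     ≈⟨ +-cong (sum-over-multiples t g m)
                                                                          (one-multiple-per-block t g mt (n∣m*n m)) ⟩
    sumR R (λ s → g (s ℕ.* suc t)) m + g mt                     ∎
    where
    mt = m ℕ.* suc t
    term : ℕ → Carrier
    term i = divInd (suc t) i * g i

  geometric-sum : ∀ z m → (z - 1#) * sumR R (pow R z) m ≈ pow R z m - 1#
  geometric-sum z zero = trans (zeroʳ _) (sym (-‿inverseʳ 1#))
  geometric-sum z (suc m) = begin
    (z - 1#) * (sumR R (pow R z) m + zᵐ)           ≈⟨ distribˡ _ _ _ ⟩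
    (z - 1#) * sumR R (pow R z) m + (z - 1#) * zᵐ   ≈⟨ +-cong (geometric-sum z m) ([y-z]x≈yx-zx zᵐ z 1#) ⟩
    (zᵐ - 1#) + (z * zᵐ - 1# * zᵐ)                  ≈⟨ +-congˡ (+-congˡ (-‿cong (*-identityˡ zᵐ))) ⟩
    (zᵐ - 1#) + (z * zᵐ - zᵐ)                       ≈⟨ +-comm _ _ ⟩
    (z * zᵐ - zᵐ) + (zᵐ - 1#)                       ≈⟨ +-assoc _ _ _ ⟩
    z * zᵐ + (- zᵐ + (zᵐ - 1#))                     ≈⟨ +-congˡ (+-assoc _ _ _) ⟨
    z * zᵐ + ((- zᵐ + zᵐ) - 1#)                     ≈⟨ +-congˡ (+-congʳ (-‿inverseˡ zᵐ)) ⟩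
    z * zᵐ + (0# - 1#)                              ≈⟨ +-congˡ (+-identityˡ _) ⟩
    z * zᵐ - 1#                                     ∎
    where
    zᵐ = pow R z m

  root-of-unity-sum : IsIntegralDomain R → ∀ z m → pow R z m ≈ 1# → ¬ z ≈ 1# → sumR R (pow R z) m ≈ 0#
  root-of-unity-sum (_ , no-zero-divisors) z m zᵐ≈1 z≉1
    with no-zero-divisors (z - 1#) (sumR R (pow R z) m)
           (trans (geometric-sum z m) (trans (+-congʳ zᵐ≈1) (-‿inverseʳ 1#)))
  ... | inj₁ z-1≈0 = ⊥-elim (z≉1 (x∙y⁻¹≈ε⇒x≈y z 1# z-1≈0))
  ... | inj₂ sum≈0 = sum≈0

module Sieve {c ℓ : Level} (R : CommutativeRing c ℓ) (domain : IsIntegralDomain R)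
             (n : ℕ) (2≤n : 2 ≤ n) (ω : CommutativeRing.Carrier R) (ω-primitive : IsPrimitiveRoot R n ω) where
  open CommutativeRing R
  open InCommutativeRing R
  open import Relation.Binary.Reasoning.Setoid setoid
  open import Algebra.Properties.Ring ring using (-0#≈0#; x[y-z]≈xy-xz; //-rightDividesˡ)

  0<n : 0 < n
  0<n = ℕP.<-≤-trans (s≤s z≤n) 2≤n

  divisor-pos : ∀ {d} → d ∣ n → 0 < d
  divisor-pos {zero}  0∣n = ⊥-elim (ℕP.<⇒≢ 0<n (≡.sym (0∣⇒≡0 0∣n)))
  divisor-pos {suc d} _   = s≤s z≤n

  w : ℕ → Carrier
  w i = pow R ω (2 ℕ.* i) - pow R ω (1 ℕ.* i)

  w-zero : w 0 ≈ 0#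
  w-zero = -‿inverseʳ 1#

  D : (ℕ → ℤ) → Carrier
  D F = sumR R (λ i → intR R (F (gcd i n)) * w i) n

  S : ℕ → Carrier
  S t = sumR R (λ i → divInd t (gcd i n) * w i) n

  divInd-gcd : ∀ {t} i → t ∣ n → divInd t (gcd i n) ≡ divInd t i
  divInd-gcd i t∣n =
    divInd-equiv (λ t∣gcd → ∣-trans t∣gcd (gcd[m,n]∣m i n)) (λ t∣i → gcd-greatest t∣i t∣n)

  G : ℕ → ℕ → ℕ → Carrier
  G j t m = sumR R (pow R (pow R ω (j ℕ.* t))) m

  S-geometric : ∀ t m → n ≡ m ℕ.* suc t → S (suc t) ≈ G 2 (suc t) m - G 1 (suc t) m
  S-geometric t m n≡mt = begin
    S T                                                 ≈⟨ sumR-cong n (λ i _ → reflexive (multiple i)) ⟩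
    sumR R (λ i → divInd T i * w i) n                   ≡⟨ ≡.cong (sumR R (λ i → divInd T i * w i)) n≡mt ⟩
    sumR R (λ i → divInd T i * w i) (m ℕ.* T)           ≈⟨ sum-over-multiples t w m ⟩
    sumR R (λ s → w (s ℕ.* T)) m                        ≈⟨ sumR-cong m (λ s _ → sub-cong (power s 2) (power s 1)) ⟩
    sumR R (λ s → pow R (ζ 2) s - pow R (ζ 1) s) m      ≈⟨ sumR-- (pow R (ζ 2)) (pow R (ζ 1)) m ⟩
    G 2 T m - G 1 T m                                   ∎
    where
    T = suc t
    T∣n : T ∣ n
    T∣n = divides m n≡mt
    multiple : ∀ i → divInd T (gcd i n) * w i ≡ divInd T i * w i
    multiple i = ≡.cong (_* w i) (divInd-gcd i T∣n)
    ζ : ℕ → Carrier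
    ζ j = pow R ω (j ℕ.* T)
    power : ∀ s j → pow R ω (j ℕ.* (s ℕ.* T)) ≈ pow R (ζ j) s
    power s j = trans (reflexive (≡.cong (pow R ω) (reassoc j s T))) (pow-* ω (j ℕ.* T) s)
      where
      reassoc : ∀ j s t → j ℕ.* (s ℕ.* t) ≡ j ℕ.* t ℕ.* s
      reassoc = ℕSolver.solve-∀
    sub-cong : ∀ {a b x y} → a ≈ x → b ≈ y → a - b ≈ x - y
    sub-cong a≈x b≈y = +-cong a≈x (-‿cong b≈y)

  ζ-root-of-unity : ∀ j t m → n ≡ m ℕ.* t → pow R (pow R ω (j ℕ.* t)) m ≈ 1#
  ζ-root-of-unity j t m n≡mt = begin
    pow R (pow R ω (j ℕ.* t)) m ≈⟨ pow-* ω (j ℕ.* t) m ⟨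
    pow R ω (j ℕ.* t ℕ.* m)     ≡⟨ ≡.cong (pow R ω) (reorder j t m) ⟩
    pow R ω (m ℕ.* t ℕ.* j)     ≡⟨ ≡.cong (λ k → pow R ω (k ℕ.* j)) n≡mt ⟨
    pow R ω (n ℕ.* j)           ≈⟨ pow-multiple-of-order n j (proj₁ ω-primitive) ⟩
    1#                          ∎
    where
    reorder : ∀ j t m → j ℕ.* t ℕ.* m ≡ m ℕ.* t ℕ.* j
    reorder = ℕSolver.solve-∀

  -- For 0 < j < m and n = m·t, ω^{jt} ≠ 1 since 0 < jt < n, so G_j(t, m) = 0.
  G-vanishes : ∀ j t m → suc j < m → n ≡ m ℕ.* suc t → G (suc j) (suc t) m ≈ 0#
  G-vanishes j t m j<m n≡mt =
    root-of-unity-sum domain (pow R ω (suc j ℕ.* suc t)) m (ζ-root-of-unity (suc j) (suc t) m n≡mt)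
      (proj₂ ω-primitive (suc j ℕ.* suc t) (s≤s z≤n) jt<n)
    where
    jt<n : suc j ℕ.* suc t < n
    jt<n = ≡.subst (suc j ℕ.* suc t <_) (≡.sym n≡mt) (ℕP.*-monoˡ-< (suc t) j<m)

  -- S(t) is 0 or 2 for every divisor t of n (it is 2 exactly when n = 2t).
  S-values : ∀ t → t ∣ n → S t ≈ 0# ⊎ S t ≈ 1# + 1#
  S-values zero    0∣n              = ⊥-elim (ℕP.<⇒≢ 0<n (≡.sym (0∣⇒≡0 0∣n)))
  S-values (suc t) (divides m n≡mt) = by-cofactor m n≡mt
    where
    by-cofactor : ∀ m → n ≡ m ℕ.* suc t → S (suc t) ≈ 0# ⊎ S (suc t) ≈ 1# + 1#
    by-cofactor zero n≡0 = ⊥-elim (ℕP.<⇒≢ 0<n (≡.sym n≡0))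
    by-cofactor 1    n≡t = inj₁ (trans (S-geometric t 1 n≡t) (-‿inverseʳ (0# + 1#)))
    by-cofactor 2    n≡2t = inj₂ (begin
      S (suc t)                        ≈⟨ S-geometric t 2 n≡2t ⟩
      G 2 (suc t) 2 - G 1 (suc t) 2    ≈⟨ +-congˡ (-‿cong (G-vanishes 0 t 2 ℕP.≤-refl n≡2t)) ⟩
      G 2 (suc t) 2 - 0#               ≈⟨ +-congˡ -0#≈0# ⟩
      G 2 (suc t) 2 + 0#               ≈⟨ +-identityʳ _ ⟩
      (0# + 1#) + ζ * 1#               ≈⟨ +-cong (+-identityˡ 1#) (trans (*-identityʳ ζ) ζ≈1) ⟩
      1# + 1#                          ∎)
      where
      ζ = pow R ω (2 ℕ.* suc t)
      ζ≈1 : ζ ≈ 1#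
      ζ≈1 = trans (reflexive (≡.cong (pow R ω) (≡.sym n≡2t))) (proj₁ ω-primitive)
    by-cofactor m@(suc (suc (suc _))) n≡mt = inj₁ (begin
      S (suc t)                        ≈⟨ S-geometric t m n≡mt ⟩
      G 2 (suc t) m - G 1 (suc t) m    ≈⟨ +-cong (G-vanishes 1 t m (s≤s (s≤s (s≤s z≤n))) n≡mt)
                                                 (-‿cong (G-vanishes 0 t m (s≤s (s≤s z≤n)) n≡mt)) ⟩
      0# - 0#                          ≈⟨ -‿inverseʳ 0# ⟩
      0#                               ∎)

  D-peel : ∀ t F → D F ≈ D (peel t F) + intR R (F t) * S t
  D-peel t F = begin
    D F                                                 ≈⟨ sumR-cong n (λ i _ → split-term (gcd i n) (w i)) ⟩
    sumR R (λ i → peeled i + intR R (F t) * (divInd t (gcd i n) * w i)) n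
                                                        ≈⟨ sumR-+ peeled _ n ⟩
    D (peel t F) + sumR R (λ i → intR R (F t) * (divInd t (gcd i n) * w i)) n
                                                        ≈⟨ +-congˡ (sumR-* (intR R (F t)) _ n) ⟩
    D (peel t F) + intR R (F t) * S t                   ∎
    where
    peeled : ℕ → Carrier
    peeled i = intR R (peel t F (gcd i n)) * w i
    split-term : ∀ d x → intR R (F d) * x ≈ intR R (peel t F d) * x + intR R (F t) * (divInd t d * x)
    split-term d x with t ∣? d
    ... | yes _ = sym (begin
      intR R (F d ℤ.- F t) * x + intR R (F t) * (1# * x)
                 ≈⟨ +-cong (*-congʳ (intR-sub (F d) (F t))) (*-congˡ (*-identityˡ x)) ⟩
      (intR R (F d) - intR R (F t)) * x + intR R (F t) * x  ≈⟨ distribʳ x _ _ ⟨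
      ((intR R (F d) - intR R (F t)) + intR R (F t)) * x    ≈⟨ *-congʳ (//-rightDividesˡ _ _) ⟩
      intR R (F d) * x                                      ∎)
    ... | no  _ = sym (begin
      intR R (F d) * x + intR R (F t) * (0# * x)  ≈⟨ +-congˡ (trans (*-congˡ (zeroˡ x)) (zeroʳ _)) ⟩
      intR R (F d) * x + 0#                       ≈⟨ +-identityʳ _ ⟩
      intR R (F d) * x                            ∎)

  VanishesBelow : ℕ → (ℕ → ℤ) → Set
  VanishesBelow t F = ∀ d → d ∣ n → d < t → F d ≡ + 0

  peel-vanishes : ∀ {t F} → VanishesBelow t F → VanishesBelow (suc t) (peel t F)
  peel-vanishes {t} {F} F↓t d d∣n d<1+t with ℕP.m<1+n⇒m<n∨m≡n d<1+t
  ... | inj₂ ≡.refl = peel-self d F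
  ... | inj₁ d<t    = ≡.trans (peel-no F t∤d) (F↓t d d∣n d<t)
    where
    t∤d : ¬ t ∣ d
    t∤d t∣d = ℕP.<⇒≱ d<t (∣⇒≤ ⦃ ℕ.>-nonZero (divisor-pos d∣n) ⦄ t∣d)

  skip-non-divisor : ∀ {t F} → ¬ t ∣ n → VanishesBelow t F → VanishesBelow (suc t) F
  skip-non-divisor {t} t∤n F↓t d d∣n d<1+t with ℕP.m<1+n⇒m<n∨m≡n d<1+t
  ... | inj₂ ≡.refl = ⊥-elim (t∤n d∣n)
  ... | inj₁ d<t    = F↓t d d∣n d<t

  EvenFromStage : ℕ → Set _
  EvenFromStage t = ∀ F → VanishesBelow t F → IsEvenInteger R (D F)

  -- Every gcd(i, n) is a divisor of n below n + 1, so at that stage D(F) = 0.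
  sieve-end : EvenFromStage (suc n)
  sieve-end F F↓ = + 0 , sumR-zero n (λ i _ → trans (*-congʳ (reflexive (≡.cong (intR R) (F-gcd≡0 i)))) (zeroˡ (w i)))
    where
    F-gcd≡0 : ∀ i → F (gcd i n) ≡ + 0
    F-gcd≡0 i = F↓ (gcd i n) (gcd[m,n]∣n i n) (s≤s (∣⇒≤ ⦃ ℕ.>-nonZero 0<n ⦄ (gcd[m,n]∣n i n)))

  -- At a divisor t, peel it off: the change F(t)·S(t) is even since S(t) ∈ {0, 2}.
  sieve-step : ∀ t → EvenFromStage (suc t) → EvenFromStage t
  sieve-step t next F F↓t with t ∣? n
  ... | no  t∤n = next F (skip-non-divisor t∤n F↓t)
  ... | yes t∣n = even-cong (D-peel t F)
                    (even-+ (next (peel t F) (peel-vanishes F↓t)) (peeled-part (S-values t t∣n)))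
    where
    peeled-part : S t ≈ 0# ⊎ S t ≈ 1# + 1# → IsEvenInteger R (intR R (F t) * S t)
    peeled-part (inj₁ S≈0) = + 0 , trans (*-congˡ S≈0) (zeroʳ _)
    peeled-part (inj₂ S≈2) = even-cong (*-congˡ S≈2) (even-double (F t))

  -- Stage 0 imposes nothing, so D(F) is even for every F.
  D-even : ∀ F → IsEvenInteger R (D F)
  D-even F = downward-induction EvenFromStage (suc n) sieve-end sieve-step 0 z≤n F (λ _ _ ())

  -- λ₂ − λ₁ = D(C): the weight c₀ = 0 may be replaced by C(gcd 0 n) since w₀ = 0.
  eigen-gap : ∀ C → eigen R n C ω 2 - eigen R n C ω 1 ≈ D C
  eigen-gap C = begin
    eigen R n C ω 2 - eigen R n C ω 1
                    ≈⟨ sumR-- (λ i → cR i * pow R ω (2 ℕ.* i)) (λ i → cR i * pow R ω (1 ℕ.* i)) n ⟨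
    sumR R (λ i → cR i * pow R ω (2 ℕ.* i) - cR i * pow R ω (1 ℕ.* i)) n
                    ≈⟨ sumR-cong n (λ i _ → sym (x[y-z]≈xy-xz (cR i) _ _)) ⟩
    sumR R (λ i → cR i * w i) n
                    ≈⟨ sumR-cong n (λ i _ → weight-vs-gcd i) ⟩
    D C             ∎
    where
    cR : ℕ → Carrier
    cR i = intR R (weight n C i)
    weight-vs-gcd : ∀ i → cR i * w i ≈ intR R (C (gcd i n)) * w i
    weight-vs-gcd zero    = trans (*-congˡ w-zero) (trans (zeroʳ _) (sym (trans (*-congˡ w-zero) (zeroʳ _))))
    weight-vs-gcd (suc i) = refl

-- The eigenvalue gap λ₂ − λ₁ of WICG(n; C) is an even integer.
lemma2 : {c ℓ : Level} (R : CommutativeRing c ℓ) → IsIntegralDomain R → CharZero R →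
         (n : ℕ) → 2 ≤ n → (ω : CommutativeRing.Carrier R) → IsPrimitiveRoot R n ω →
         (C : ℕ → ℤ) →
         IsEvenInteger R (CommutativeRing._-_ R (eigen R n C ω 2) (eigen R n C ω 1))
lemma2 R domain _ n 2≤n ω ω-primitive C = even-cong (eigen-gap C) (D-even C)
  where
  open Sieve R domain n 2≤n ω ω-primitive
  open InCommutativeRing R using (even-cong)
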